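{- Let $\lambda>1$ be an ordinal and let $\Omega=\langle \omega^{\omega^\lambda};\times,1,\omega,\omega+1,\omega^2+1\rangle$. The relation $$\texttt{Div}=\{((\omega+1)^{i},(\omega+1)^{j})\mid i,j\in\mathbb{N},\ i \text{ divides } j\}$$ is definable in $\Omega$ by a formula of the form $\exists z,t\,E(x,y,z,t)$ where $E$ is quantifier-free.
   Context: $\Omega$ is the structure with domain the ordinal $\omega^{\omega^\lambda}$, the ordinal multiplication $\times$ and the constants $1,\omega,\omega+1,\omega^2+1$. Divisibility is on nonnegative integers: $i$ divides $j$ iff $j=ic$ for some $c\in\mathbb{N}$. -}

module Defs where

open import Data.Nat using (ℕ; zero; suc; _+_; _*_; _≥_)
open import Data.Nat.Divisibility using (_∣_)
open import Data.Fin using (Fin)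
open import Data.List using (List; []; _∷_)
open import Data.List.Relation.Unary.All using (All)
open import Data.List.Relation.Unary.Linked using (Linked)
open import Data.Product using (Σ; _×_; _,_; proj₁; proj₂; ∃-syntax)
open import Data.Sum using (_⊎_)
open import Relation.Nullary using (¬_)
open import Relation.Binary.PropositionalEquality using (_≡_)
open import Relation.Binary.Definitions using (tri<; tri≈; tri>)
open import Relation.Binary.Structures using (IsStrictTotalOrder)
open import Induction.WellFounded using (WellFounded)

-- An ordinal λ > 1, presented as its set of predecessors {β | β < λ}:
-- a well-ordered set (strict total order, well-founded) containing
-- 0 (its least element) and 1 (an element above 0).
record OrdinalGt1 : Set₁ where
  field
    Carrier    : Set
    _<_        : Carrier → Carrier → Set
    isSTO      : IsStrictTotalOrder _≡_ _<_
    wf         : WellFounded _<_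
    zeroO      : Carrier
    zero-least : ∀ x → ¬ (x < zeroO)
    oneO       : Carrier
    zero<one   : zeroO < oneO

module _ (Λ : OrdinalGt1) where
  open OrdinalGt1 Λ renaming (Carrier to L)
  open IsStrictTotalOrder isSTO using (compare)

  -- Elements of ω^λ in Cantor normal form:  ω^{β₁}·m₁ + … + ω^{βₖ}·mₖ
  -- encoded as the list ((β₁ , m₁) ∷ … ∷ (βₖ , mₖ) ∷ []).
  Exp : Set
  Exp = List (L × ℕ)

  ValidExp : Exp → Set
  ValidExp e = Linked (λ s t → proj₁ t < proj₁ s) e × All (λ s → proj₂ s ≥ 1) e

  data _<ᴱ_ : Exp → Exp → Set where
    []<∷  : ∀ {t ts} → [] <ᴱ (t ∷ ts)
    head< : ∀ {a b m n xs ys} → a < b → ((a , m) ∷ xs) <ᴱ ((b , n) ∷ ys)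
    coef< : ∀ {a m n xs ys} → m Data.Nat.< n → ((a , m) ∷ xs) <ᴱ ((a , n) ∷ ys)
    tail< : ∀ {a m xs ys} → xs <ᴱ ys → ((a , m) ∷ xs) <ᴱ ((a , m) ∷ ys)

  _⊕_ : Exp → Exp → Exp
  a ⊕ [] = a
  a ⊕ ((b , m) ∷ bs) = go a
    where
    go : Exp → Exp
    go [] = (b , m) ∷ bs
    go ((c , k) ∷ cs) with compare c b
    ... | tri< _ _ _ = (b , m) ∷ bs
    ... | tri≈ _ _ _ = (c , k + m) ∷ bs
    ... | tri> _ _ _ = (c , k) ∷ go cs

  -- Elements of ω^(ω^λ) in Cantor normal form: ω^{α₁}·n₁ + … + ω^{αₖ}·nₖ
  -- with α₁ > … > αₖ in ω^λ and nᵢ ≥ 1.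
  Raw : Set
  Raw = List (Exp × ℕ)

  Valid : Raw → Set
  Valid x = All (λ s → ValidExp (proj₁ s)) x
          × Linked (λ s t → proj₁ t <ᴱ proj₁ s) x
          × All (λ s → proj₂ s ≥ 1) x

  Ω : Set
  Ω = Σ Raw Valid

  -- Ordinal multiplication on Cantor normal forms:
  -- (ω^α·n + xs)·(ω^β·m) = ω^(α+β)·m  for β > 0,
  -- (ω^α·n + xs)·m       = ω^α·(n·m) + xs  for finite m ≥ 1,
  -- and left distributivity over the terms of the right factor.
  mulAux : Exp → ℕ → Raw → Raw → Raw
  mulAux α n xs [] = []
  mulAux α n xs (([] , m) ∷ ys) = (α , n * m) ∷ xs
  mulAux α n xs (((b ∷ bs) , m) ∷ ys) = ((α ⊕ (b ∷ bs)) , m) ∷ mulAux α n xs ys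

  _⊗_ : Raw → Raw → Raw
  [] ⊗ y = []
  ((α , n) ∷ xs) ⊗ y = mulAux α n xs y

  oneΩ : Raw
  oneΩ = ([] , 1) ∷ []

  ωΩ : Raw
  ωΩ = (((zeroO , 1) ∷ []) , 1) ∷ []

  ω+1Ω : Raw
  ω+1Ω = (((zeroO , 1) ∷ []) , 1) ∷ ([] , 1) ∷ []

  ω²+1Ω : Raw
  ω²+1Ω = (((zeroO , 2) ∷ []) , 1) ∷ ([] , 1) ∷ []

  pow : Raw → ℕ → Raw
  pow x zero = oneΩ
  pow x (suc i) = pow x i ⊗ x

  Div : Ω → Ω → Set
  Div x y = ∃[ i ] ∃[ j ] (proj₁ x ≡ pow ω+1Ω i × proj₁ y ≡ pow ω+1Ω j × i ∣ j)

data Term (n : ℕ) : Set where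
  var   : Fin n → Term n
  _·_   : Term n → Term n → Term n
  c1    : Term n
  cω    : Term n
  cω+1  : Term n
  cω²+1 : Term n

data QF (n : ℕ) : Set where
  _≐_  : Term n → Term n → QF n
  ¬ᶠ_  : QF n → QF n
  _∧ᶠ_ : QF n → QF n → QF n
  _∨ᶠ_ : QF n → QF n → QF n

module _ (Λ : OrdinalGt1) where
  evalT : ∀ {n} → (Fin n → Ω Λ) → Term n → Raw Λ
  evalT ρ (var i) = proj₁ (ρ i)
  evalT ρ (s · t) = _⊗_ Λ (evalT ρ s) (evalT ρ t)
  evalT ρ c1 = oneΩ Λ
  evalT ρ cω = ωΩ Λ
  evalT ρ cω+1 = ω+1Ω Λ
  evalT ρ cω²+1 = ω²+1Ω Λ

  Sat : ∀ {n} → (Fin n → Ω Λ) → QF n → Set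
  Sat ρ (s ≐ t) = evalT ρ s ≡ evalT ρ t
  Sat ρ (¬ᶠ φ) = ¬ Sat ρ φ
  Sat ρ (φ ∧ᶠ ψ) = Sat ρ φ × Sat ρ ψ
  Sat ρ (φ ∨ᶠ ψ) = Sat ρ φ ⊎ Sat ρ ψ

env4 : ∀ {A : Set} → A → A → A → A → Fin 4 → A
env4 x y z t Fin.zero = x
env4 x y z t (Fin.suc Fin.zero) = y
env4 x y z t (Fin.suc (Fin.suc Fin.zero)) = z
env4 x y z t (Fin.suc (Fin.suc (Fin.suc Fin.zero))) = t

-- The powers (ω+1)ⁿ = ωⁿ + ωⁿ⁻¹ + … + 1 are exactly the nonzero elements of Ω
-- commuting with ω+1. For i = n+2 write x = z·(ω+1)², so z = (ω+1)ⁿ, and let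
-- B = z·(ω²+1) = ω^(n+2) + (ω+1)ⁿ. Suppose t commutes with B and t·ω = y·ω, i.e.
-- t has the leading exponent j of y = (ω+1)ʲ. Then all exponents of t are finite,
-- and writing t = ω^j + t′, comparing t·B = ω^(j+n+2) + ω^(j+n) + … + ω^j + t′
-- with B·t shows that the exponents j+n, …, j are those of (ω+1)ⁿ with n+2 added
-- to some of them. Hence (n+1)·j ≡ 0 mod n+2, and n+2 ∣ j since n+1 and n+2 are
-- coprime. Conversely t = B^q witnesses j = q(n+2); the cases i = 0, 1 get their own disjuncts.
module Submission where

open import Defs hiding (_⊗_; _⊕_; _<ᴱ_)
open import Data.Nat using (ℕ; zero; suc; _+_; _*_; _≤_; _<_; s≤s; z≤n)
open import Data.Nat.Properties
open import Data.Nat.Tactic.RingSolver using (solve-∀)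
open import Data.Nat.Divisibility using (_∣_; divides; _∣0; 1∣_; 0∣⇒≡0)
open import Data.Nat.Coprimality using (Coprime; coprime-divisor; coprime-+; 1-coprimeTo)
open import Data.List using (List; []; _∷_; _++_; length; map)
open import Data.Nat.ListAction using (sum)
open import Data.Nat.ListAction.Properties using (sum-++)
open import Data.List.Properties using (∷-injective; ∷-injectiveˡ; ∷-injectiveʳ; length-++; ++-assoc; ++-identityʳ; map-++; map-injective)
open import Data.List.Relation.Unary.All using (All; []; _∷_)
open import Data.List.Relation.Unary.Linked using (Linked; []; [-]; _∷_)
open import Data.Product using (Σ; _×_; _,_; proj₁; proj₂; ∃-syntax; map₁)
open import Data.Product.Properties using (,-injectiveˡ; ,-injectiveʳ)
open import Data.Sum using (inj₁; inj₂)
open import Data.Empty using (⊥-elim)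
open import Data.Unit using (⊤; tt)
open import Data.Fin using () renaming (zero to fz; suc to fs)
open import Relation.Binary.PropositionalEquality
open import Relation.Binary.Definitions using (tri<; tri≈; tri>)
open import Relation.Binary.Structures using (IsStrictTotalOrder)

-- Cantor normal forms with exponents in ℕ: (e , c) stands for ω^e·c.
NatCNF : Set
NatCNF = List (ℕ × ℕ)

infixl 7 _⊛_
_⊛_ : NatCNF → NatCNF → NatCNF
[]             ⊛ _                  = []
(_ ∷ _)        ⊛ []                 = []
((a , n) ∷ xs) ⊛ ((zero  , m) ∷ ys) = (a , n * m) ∷ xs
((a , n) ∷ xs) ⊛ ((suc k , m) ∷ ys) = (a + suc k , m) ∷ ((a , n) ∷ xs) ⊛ ys

ωN ω+1N ω²+1N : NatCNF
ωN    = (1 , 1) ∷ []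
ω+1N  = (1 , 1) ∷ (0 , 1) ∷ []
ω²+1N = (2 , 1) ∷ (0 , 1) ∷ []

stair : ℕ → ℕ → NatCNF
stair K zero    = (K , 1) ∷ []
stair K (suc n) = (K + suc n , 1) ∷ stair K n

ω+1^ : ℕ → NatCNF
ω+1^ = stair 0

B : ℕ → NatCNF
B n = (suc (suc n) , 1) ∷ ω+1^ n

blocks : ℕ → ℕ → NatCNF
blocks n zero    = ω+1^ n
blocks n (suc q) = stair (suc (suc n) * suc q) n ++ blocks n q

-- The closed form of (B n)^q.
powB : ℕ → ℕ → NatCNF
powB n zero    = (0 , 1) ∷ []
powB n (suc q) = (suc (suc n) * suc q , 1) ∷ blocks n q

length-stair : ∀ K n → length (stair K n) ≡ suc n
length-stair K zero    = refl
length-stair K (suc n) = cong suc (length-stair K n)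

ω+1^-injective : ∀ {i i′} → ω+1^ i ≡ ω+1^ i′ → i ≡ i′
ω+1^-injective {zero}  {zero}   _  = refl
ω+1^-injective {suc i} {suc i′} eq = ,-injectiveˡ (∷-injectiveˡ eq)

ω+1^-⊛-ω : ∀ j → ω+1^ j ⊛ ωN ≡ (suc j , 1) ∷ []
ω+1^-⊛-ω zero    = refl
ω+1^-⊛-ω (suc j) = cong (λ e → (e , 1) ∷ []) (+-comm (suc j) 1)

ω+1^≢ω+1^⊛ω : ∀ i → ω+1^ i ≢ ω+1^ i ⊛ ωN
ω+1^≢ω+1^⊛ω zero          ()
ω+1^≢ω+1^⊛ω (suc zero)    ()
ω+1^≢ω+1^⊛ω (suc (suc i)) ()

ω+1^-⊛-ω+1 : ∀ n → ω+1^ n ⊛ ω+1N ≡ ω+1^ (suc n)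
ω+1^-⊛-ω+1 zero    = refl
ω+1^-⊛-ω+1 (suc n) = cong (λ e → (e , 1) ∷ ω+1^ (suc n)) (cong suc (+-comm n 1))

ω+1^-⊛-ω²+1 : ∀ n → ω+1^ n ⊛ ω²+1N ≡ B n
ω+1^-⊛-ω²+1 zero    = refl
ω+1^-⊛-ω²+1 (suc n) = cong (λ e → (e , 1) ∷ ω+1^ (suc n)) (cong suc (+-comm n 2))

⊛-ω+1^ : ∀ a s n → ((a , 1) ∷ s) ⊛ ω+1^ n ≡ stair a n ++ s
⊛-ω+1^ a s zero    = refl
⊛-ω+1^ a s (suc n) = cong ((a + suc n , 1) ∷_) (⊛-ω+1^ a s n)

⊛-stair-++ : ∀ a c s K n Z →
             ((a , c) ∷ s) ⊛ (stair (suc K) n ++ Z) ≡ stair (a + suc K) n ++ ((a , c) ∷ s) ⊛ Z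
⊛-stair-++ a c s K zero    Z = refl
⊛-stair-++ a c s K (suc n) Z =
  cong₂ _∷_ (cong (_, 1) (sym (+-assoc a (suc K) (suc n)))) (⊛-stair-++ a c s K n Z)

stair-1-++-1 : ∀ n → stair 1 n ++ (0 , 1) ∷ [] ≡ ω+1^ (suc n)
stair-1-++-1 zero    = refl
stair-1-++-1 (suc n) = cong ((suc (suc n) , 1) ∷_) (stair-1-++-1 n)

ω+1-⊛-ω+1^ : ∀ n → ω+1N ⊛ ω+1^ n ≡ ω+1^ (suc n)
ω+1-⊛-ω+1^ n = trans (⊛-ω+1^ 1 ((0 , 1) ∷ []) n) (stair-1-++-1 n)

B-⊛-blocks : ∀ n q → B n ⊛ blocks n q ≡ blocks n (suc q)
B-⊛-blocks n zero =
  trans (⊛-ω+1^ (suc (suc n)) (ω+1^ n) n)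
        (cong (λ a → stair a n ++ ω+1^ n) (sym (*-identityʳ (suc (suc n)))))
B-⊛-blocks n (suc q) =
  trans (⊛-stair-++ (suc (suc n)) 1 (ω+1^ n) (q + suc n * suc q) n (blocks n q))
        (cong₂ _++_ (cong (λ a → stair a n) (sym (*-suc (suc (suc n)) (suc q))))
                    (B-⊛-blocks n q))

powB-⊛-B : ∀ n q → powB n q ⊛ B n ≡ B n ⊛ powB n q
powB-⊛-B n zero = cong ((suc (suc n) , 1) ∷_) (trans (⊛-ω+1^ 0 [] n) (++-identityʳ (ω+1^ n)))
powB-⊛-B n (suc q) =
  cong₂ _∷_ (cong (_, 1) (+-comm (suc (suc n) * suc q) (suc (suc n))))
            (trans (⊛-ω+1^ (suc (suc n) * suc q) (blocks n q) n) (sym (B-⊛-blocks n q)))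

powB-⊛-ω : ∀ n q → powB n q ⊛ ωN ≡ (suc (q * suc (suc n)) , 1) ∷ []
powB-⊛-ω n zero    = refl
powB-⊛-ω n (suc q) =
  cong (λ a → (a , 1) ∷ []) (trans (+-comm (suc (suc n) * suc q) 1) (cong suc (*-comm (suc (suc n)) (suc q))))

DescendingBelow : ℕ → NatCNF → Set
DescendingBelow b []            = ⊤
DescendingBelow b ((e , c) ∷ s) = e < b × 1 ≤ c × DescendingBelow e s

DescendingBelow-weaken : ∀ {b b′} s → DescendingBelow b s → b ≤ b′ → DescendingBelow b′ s
DescendingBelow-weaken []      _                 _    = tt
DescendingBelow-weaken (_ ∷ _) (e<b , c≥1 , ds) b≤b′ = <-≤-trans e<b b≤b′ , c≥1 , ds

stair-++-descending : ∀ b K n Z → K + n < b → DescendingBelow K Z → DescendingBelow b (stair K n ++ Z)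
stair-++-descending b K zero    Z lt dZ = subst (_< b) (+-identityʳ K) lt , s≤s z≤n , dZ
stair-++-descending b K (suc n) Z lt dZ =
  lt , s≤s z≤n , stair-++-descending (K + suc n) K n Z (+-monoʳ-< K (n<1+n n)) dZ

ω+1^-descending : ∀ n → DescendingBelow (suc n) (ω+1^ n)
ω+1^-descending n =
  subst (DescendingBelow (suc n)) (++-identityʳ (ω+1^ n)) (stair-++-descending (suc n) 0 n [] (n<1+n n) tt)

blocks-descending : ∀ n q → DescendingBelow (suc (suc n) * suc q) (blocks n q)
blocks-descending n zero =
  DescendingBelow-weaken (ω+1^ n) (ω+1^-descending n)
    (≤-trans (n≤1+n (suc n)) (≤-reflexive (sym (*-identityʳ (suc (suc n))))))
blocks-descending n (suc q) =
  stair-++-descending (i * suc (suc q)) (i * suc q) n (blocks n q) lt (blocks-descending n q)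
  where
  i = suc (suc n)
  lt : i * suc q + n < i * suc (suc q)
  lt = <-≤-trans (+-monoʳ-< (i * suc q) (≤-trans (n<1+n n) (n≤1+n (suc n))))
                 (≤-reflexive (trans (+-comm (i * suc q) i) (sym (*-suc i (suc q)))))

powB-descending : ∀ n q → DescendingBelow (suc (suc (suc n) * q)) (powB n q)
powB-descending n zero    = s≤s z≤n , s≤s z≤n , tt
powB-descending n (suc q) = ≤-refl , s≤s z≤n , blocks-descending n q

expSum : NatCNF → ℕ
expSum s = sum (map proj₁ s)

expSum-++ : ∀ U V → expSum (U ++ V) ≡ expSum U + expSum V
expSum-++ U V = trans (cong sum (map-++ proj₁ U V)) (sum-++ (map proj₁ U) (map proj₁ V))

expSum-stair : ∀ K n → expSum (stair K n) ≡ K * suc n + expSum (ω+1^ n)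
expSum-stair K zero    = cong (_+ 0) (sym (*-identityʳ K))
expSum-stair K (suc n) = trans (cong (K + suc n +_) (expSum-stair K n)) (regroup K n (expSum (ω+1^ n)))
  where
  regroup : ∀ K n S → K + suc n + (K * suc n + S) ≡ K * suc (suc n) + (suc n + S)
  regroup = solve-∀

-- Each infinite term ω^k of s contributes ω^(a+k) on the left and ω^k on the
-- right, so U is P rotated with a added to some of its entries.
⊛-prefix-expSum : ∀ a c P s U → length U ≡ length P → ((a , c) ∷ P) ⊛ s ≡ U ++ s →
                  ∃[ q ] expSum U ≡ expSum P + a * q
⊛-prefix-expSum a c [] s [] _ _ = 0 , sym (*-zeroʳ a)
⊛-prefix-expSum a c (_ ∷ _) [] (_ ∷ _) _ ()
⊛-prefix-expSum a c P ((zero , m) ∷ []) U _ eq = 1 , (begin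
  expSum U                      ≡⟨ sym (+-identityʳ (expSum U)) ⟩
  expSum U + 0                  ≡⟨ sym (trans (cong expSum eq) (expSum-++ U ((0 , m) ∷ []))) ⟩
  a + expSum P                  ≡⟨ +-comm a (expSum P) ⟩
  expSum P + a                  ≡⟨ cong (expSum P +_) (sym (*-identityʳ a)) ⟩
  expSum P + a * 1              ∎)
  where open ≡-Reasoning
⊛-prefix-expSum a c P ((zero , m) ∷ x ∷ r) U len eq =
  ⊥-elim (m+1+n≢m (length P) (sym (suc-injective (begin
    suc (length P)                                  ≡⟨ cong length eq ⟩
    length (U ++ (0 , m) ∷ x ∷ r)                   ≡⟨ length-++ U ⟩
    length U + suc (suc (length r))                 ≡⟨ cong (_+ suc (suc (length r))) len ⟩
    length P + suc (suc (length r))                 ≡⟨ +-suc (length P) (suc (length r)) ⟩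
    suc (length P + suc (length r))                 ∎))))
  where open ≡-Reasoning
⊛-prefix-expSum a c (p ∷ P) ((suc k , m) ∷ r) (u ∷ U) len eq
  with refl , eq′ ← ∷-injective eq
  with q , IH ← ⊛-prefix-expSum a c (p ∷ P) r (U ++ (suc k , m) ∷ [])
                  (trans (length-++ U) (trans (+-comm (length U) 1) len))
                  (trans eq′ (sym (++-assoc U ((suc k , m) ∷ []) r))) = suc q , (begin
  a + suc k + expSum U                        ≡⟨ regroup a k (expSum U) ⟩
  a + (expSum U + (suc k + 0))                ≡⟨ cong (a +_) (trans (sym (expSum-++ U _)) IH) ⟩
  a + (expSum (p ∷ P) + a * q)                ≡⟨ absorb a (expSum (p ∷ P)) q ⟩
  expSum (p ∷ P) + a * suc q                  ∎)
  where
  open ≡-Reasoning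
  regroup : ∀ a k E → a + suc k + E ≡ a + (E + (suc k + 0))
  regroup = solve-∀
  absorb : ∀ a S q → a + (S + a * q) ≡ S + a * suc q
  absorb = solve-∀

stair-++≡B-⊛⇒∣ : ∀ n j s → stair j n ++ s ≡ B n ⊛ s → suc (suc n) ∣ j
stair-++≡B-⊛⇒∣ n j s eq
  with q , e ← ⊛-prefix-expSum (suc (suc n)) 1 (ω+1^ n) s (stair j n)
                 (trans (length-stair j n) (sym (length-stair 0 n))) (sym eq) =
  coprime-divisor coprime (divides q (begin
    suc n * j                ≡⟨ *-comm (suc n) j ⟩
    j * suc n                ≡⟨ +-cancelʳ-≡ P _ _ (trans (sym (expSum-stair j n)) (trans e (+-comm P _))) ⟩
    suc (suc n) * q          ≡⟨ *-comm (suc (suc n)) q ⟩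
    q * suc (suc n)          ∎))
  where
  open ≡-Reasoning
  P = expSum (ω+1^ n)
  coprime : Coprime (suc (suc n)) (suc n)
  coprime = subst (λ m → Coprime m (suc n)) (+-comm (suc n) 1) (coprime-+ (1-coprimeTo (suc n)))

commutes-with-B⇒∣-lead : ∀ n a c r → ((a , c) ∷ r) ⊛ B n ≡ B n ⊛ ((a , c) ∷ r) → suc (suc n) ∣ a
commutes-with-B⇒∣-lead n zero    c r comm = _ ∣0
commutes-with-B⇒∣-lead n (suc a) c r comm with refl ← ,-injectiveʳ (∷-injectiveˡ comm) =
  stair-++≡B-⊛⇒∣ n (suc a) r (trans (sym (⊛-ω+1^ (suc a) r n)) (∷-injectiveʳ comm))

commutes-with-B⇒∣ : ∀ n j s → s ⊛ B n ≡ B n ⊛ s → s ⊛ ωN ≡ (suc j , 1) ∷ [] → suc (suc n) ∣ j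
commutes-with-B⇒∣ n j ((a , c) ∷ r) comm ω-eq =
  subst (suc (suc n) ∣_) (suc-injective (trans (+-comm 1 a) (,-injectiveˡ (∷-injectiveˡ ω-eq))))
        (commutes-with-B⇒∣-lead n a c r comm)

vx vy vz vt : Term 4
vx = var fz
vy = var (fs fz)
vz = var (fs (fs fz))
vt = var (fs (fs (fs fz)))

isPowerOfω+1 : Term 4 → QF 4
isPowerOfω+1 v = ((v · cω+1) ≐ (cω+1 · v)) ∧ᶠ (¬ᶠ (v ≐ (v · cω)))

bothOne xIsω+1 witnessedDivision : QF 4
bothOne = (vx ≐ c1) ∧ᶠ (vy ≐ c1)
xIsω+1 = vx ≐ cω+1
witnessedDivision =
  (((vz · cω+1) · cω+1) ≐ vx)
  ∧ᶠ (((vt · (vz · cω²+1)) ≐ ((vz · cω²+1) · vt)) ∧ᶠ ((vt · cω) ≐ (vy · cω)))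

divFormula : QF 4
divFormula = isPowerOfω+1 vx ∧ᶠ (isPowerOfω+1 vy ∧ᶠ (bothOne ∨ᶠ (xIsω+1 ∨ᶠ witnessedDivision)))

module _ (Λ : OrdinalGt1) where
  open OrdinalGt1 Λ using (isSTO; zeroO; zero-least)
  open IsStrictTotalOrder isSTO using (compare)

  infixl 7 _⊗_
  _⊗_ : Raw Λ → Raw Λ → Raw Λ
  _⊗_ = Defs._⊗_ Λ

  _⊕_ : Exp Λ → Exp Λ → Exp Λ
  _⊕_ = Defs._⊕_ Λ

  _<ᴱ_ : Exp Λ → Exp Λ → Set
  _<ᴱ_ = Defs._<ᴱ_ Λ

  fin : ℕ → Exp Λ
  fin zero    = []
  fin (suc k) = (zeroO , suc k) ∷ []

  embed : NatCNF → Raw Λ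
  embed = map (map₁ fin)

  fin-injective : ∀ {a b} → fin a ≡ fin b → a ≡ b
  fin-injective {zero}  {zero}  _  = refl
  fin-injective {suc a} {suc b} eq = ,-injectiveʳ (∷-injectiveˡ eq)

  embed-injective : ∀ {s s′} → embed s ≡ embed s′ → s ≡ s′
  embed-injective = map-injective λ eq → cong₂ _,_ (fin-injective (,-injectiveˡ eq)) (,-injectiveʳ eq)

  fin-⊕ : ∀ a k → fin a ⊕ fin (suc k) ≡ fin (a + suc k)
  fin-⊕ zero    k = refl
  fin-⊕ (suc a) k with compare zeroO zeroO
  ... | tri< _ 0≢0 _ = ⊥-elim (0≢0 refl)
  ... | tri≈ _ _ _   = refl
  ... | tri> _ 0≢0 _ = ⊥-elim (0≢0 refl)

  embed-⊛ : ∀ xs ys → embed xs ⊗ embed ys ≡ embed (xs ⊛ ys)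
  embed-⊛ []             ys                 = refl
  embed-⊛ (_ ∷ _)        []                 = refl
  embed-⊛ ((a , n) ∷ xs) ((zero  , m) ∷ ys) = refl
  embed-⊛ ((a , n) ∷ xs) ((suc k , m) ∷ ys) =
    cong₂ _∷_ (cong (_, m) (fin-⊕ a k)) (embed-⊛ ((a , n) ∷ xs) ys)

  embed-⊛-injective : ∀ {xs ys zs ws} → embed xs ⊗ embed ys ≡ embed zs ⊗ embed ws → xs ⊛ ys ≡ zs ⊛ ws
  embed-⊛-injective {xs} {ys} {zs} {ws} eq =
    embed-injective (trans (sym (embed-⊛ xs ys)) (trans eq (embed-⊛ zs ws)))

  pow-ω+1 : ∀ n → pow Λ (ω+1Ω Λ) n ≡ embed (ω+1^ n)
  pow-ω+1 zero    = refl
  pow-ω+1 (suc n) =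
    trans (cong (_⊗ ω+1Ω Λ) (pow-ω+1 n)) (trans (embed-⊛ (ω+1^ n) ω+1N) (cong embed (ω+1^-⊛-ω+1 n)))

  fin-valid : ∀ e → ValidExp Λ (fin e)
  fin-valid zero    = [] , []
  fin-valid (suc e) = [-] , (s≤s z≤n ∷ [])

  fin-< : ∀ {a b} → a < b → fin a <ᴱ fin b
  fin-< {zero}  {suc b} _  = []<∷
  fin-< {suc a} {suc b} lt = coef< lt

  embed-valid : ∀ {b} s → DescendingBelow b s → Valid Λ (embed s)
  embed-valid [] _ = [] , [] , []
  embed-valid ((e , c) ∷ []) (_ , c≥1 , _) = fin-valid e ∷ [] , [-] , c≥1 ∷ []
  embed-valid ((e , c) ∷ s@(_ ∷ _)) (_ , c≥1 , ds@(e′<e , _)) with embed-valid s ds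
  ... | vs , lk , cs = fin-valid e ∷ vs , fin-< e′<e ∷ lk , c≥1 ∷ cs

  IsPowerOfω+1 : Raw Λ → Set
  IsPowerOfω+1 x = x ⊗ ω+1Ω Λ ≡ ω+1Ω Λ ⊗ x × x ≢ x ⊗ ωΩ Λ

  ω+1^-isPower : ∀ i → IsPowerOfω+1 (embed (ω+1^ i))
  ω+1^-isPower i = commutes , λ eq → ω+1^≢ω+1^⊛ω i (embed-injective (trans eq (embed-⊛ (ω+1^ i) ωN)))
    where
    commutes : embed (ω+1^ i) ⊗ ω+1Ω Λ ≡ ω+1Ω Λ ⊗ embed (ω+1^ i)
    commutes = trans (embed-⊛ (ω+1^ i) ω+1N)
                 (trans (cong embed (trans (ω+1^-⊛-ω+1 i) (sym (ω+1-⊛-ω+1^ i))))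
                        (sym (embed-⊛ ω+1N (ω+1^ i))))

  ≡ω+1⊗tail⇒power : ∀ α xs → (α , 1) ∷ xs ≡ ω+1Ω Λ ⊗ xs → ∃[ k ] (α , 1) ∷ xs ≡ embed (ω+1^ (suc k))
  ≡ω+1⊗tail⇒power α (([] , m) ∷ ys) eq with h , t ← ∷-injective eq =
    0 , cong₂ _∷_ (cong (_, 1) (,-injectiveˡ h)) t
  ≡ω+1⊗tail⇒power α ((b ∷ bs , m) ∷ ys) eq
    with h , t ← ∷-injective eq
    with refl ← ,-injectiveʳ h
    with k , e ← ≡ω+1⊗tail⇒power (b ∷ bs) ys t =
    suc k , cong₂ _∷_ (cong (_, 1) α≡) e
    where
    α≡ : α ≡ fin (suc (suc k))
    α≡ = trans (,-injectiveˡ h) (trans (cong (fin 1 ⊕_) (,-injectiveˡ (∷-injectiveˡ e))) (fin-⊕ 1 k))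

  power-of-ω+1 : ∀ x → IsPowerOfω+1 x → ∃[ i ] x ≡ embed (ω+1^ i)
  power-of-ω+1 [] (_ , x≢0) = ⊥-elim (x≢0 refl)
  power-of-ω+1 (([] , n) ∷ xs) (comm , _)
    with h , t ← ∷-injective (∷-injectiveʳ comm) =
    0 , cong₂ _∷_ (cong ([] ,_) (trans (sym (*-identityʳ n)) (,-injectiveʳ h))) t
  power-of-ω+1 ((b ∷ bs , n) ∷ xs) (comm , _)
    with refl ← ,-injectiveʳ (∷-injectiveˡ comm)
    with k , e ← ≡ω+1⊗tail⇒power (b ∷ bs) xs (∷-injectiveʳ comm) = suc k , e

  ⊗ω+1≢1 : ∀ x → x ⊗ ω+1Ω Λ ≢ oneΩ Λ
  ⊗ω+1≢1 []      ()
  ⊗ω+1≢1 (_ ∷ _) ()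

  ⊗ω+1-cancel : ∀ x n → x ⊗ ω+1Ω Λ ≡ embed (ω+1^ (suc n)) → x ≡ embed (ω+1^ n)
  ⊗ω+1-cancel ((α , c) ∷ xs) n eq = subst (λ c′ → (α , c′) ∷ xs ≡ _) (*-identityʳ c) (∷-injectiveʳ eq)

  ⊗ω+1²≡power : ∀ z i → z ⊗ ω+1Ω Λ ⊗ ω+1Ω Λ ≡ embed (ω+1^ i) →
                ∃[ n ] i ≡ suc (suc n) × z ≡ embed (ω+1^ n)
  ⊗ω+1²≡power z zero          eq = ⊥-elim (⊗ω+1≢1 (z ⊗ ω+1Ω Λ) eq)
  ⊗ω+1²≡power z (suc zero)    eq = ⊥-elim (⊗ω+1≢1 z (⊗ω+1-cancel (z ⊗ ω+1Ω Λ) 0 eq))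
  ⊗ω+1²≡power z (suc (suc n)) eq = n , refl , ⊗ω+1-cancel z n (⊗ω+1-cancel (z ⊗ ω+1Ω Λ) (suc n) eq)

  valid-at-zero : ∀ {k bs} → ValidExp Λ ((zeroO , k) ∷ bs) → (zeroO , k) ∷ bs ≡ fin k
  valid-at-zero {bs = []}          (_ , (s≤s z≤n ∷ _)) = refl
  valid-at-zero {bs = (c , _) ∷ _} (c<0 ∷ _ , _)       = ⊥-elim (zero-least c c<0)

  ⊕1≡fin⇒fin : ∀ {b j} → ValidExp Λ b → b ⊕ fin 1 ≡ fin (suc j) → b ≡ fin j
  ⊕1≡fin⇒fin {[]} _ eq with refl ← fin-injective eq = refl
  ⊕1≡fin⇒fin {(c , k) ∷ bs} v eq with compare c zeroO
  ... | tri< c<0 _ _  = ⊥-elim (zero-least c c<0)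
  ... | tri> _ c≢0 _  = ⊥-elim (c≢0 (,-injectiveˡ (∷-injectiveˡ eq)))
  ... | tri≈ _ refl _ =
    trans (valid-at-zero v) (cong fin (suc-injective (trans (+-comm 1 k) (,-injectiveʳ (∷-injectiveˡ eq)))))

  below-fin⇒fin : ∀ {e a} → ValidExp Λ e → e <ᴱ fin a → ∃[ k ] e ≡ fin k
  below-fin⇒fin {[]}          {suc a} _ _             = 0 , refl
  below-fin⇒fin {(c , _) ∷ _} {suc a} _ (head< c<0)   = ⊥-elim (zero-least c c<0)
  below-fin⇒fin {(_ , k) ∷ _} {suc a} v (coef< _)     = k , valid-at-zero v
  below-fin⇒fin {_ ∷ _}       {suc a} _ (tail< ())

  descending-from-fin⇒embed : ∀ a m ts → Linked (λ s t → proj₁ t <ᴱ proj₁ s) ((fin a , m) ∷ ts) →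
                              All (λ s → ValidExp Λ (proj₁ s)) ts → ∃[ s ] ts ≡ embed s
  descending-from-fin⇒embed a m [] _ _ = [] , refl
  descending-from-fin⇒embed a m ((e , c) ∷ ts) (e<a ∷ lk) (ve ∷ vts)
    with k , refl ← below-fin⇒fin ve e<a
    with s , refl ← descending-from-fin⇒embed k c ts lk vts = (k , c) ∷ s , refl

  ⊗ω≡fin⇒embed : ∀ t j → Valid Λ t → t ⊗ ωΩ Λ ≡ embed ((suc j , 1) ∷ []) → ∃[ s ] t ≡ embed s
  ⊗ω≡fin⇒embed ((b , m) ∷ ts) j (vb ∷ vts , lk , _) eq
    with refl ← ⊕1≡fin⇒fin vb (,-injectiveˡ (∷-injectiveˡ eq))
    with s , refl ← descending-from-fin⇒embed j m ts lk vts = (j , m) ∷ s , refl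

  ω+1^-⊗-ω : ∀ j → embed (ω+1^ j) ⊗ ωΩ Λ ≡ embed ((suc j , 1) ∷ [])
  ω+1^-⊗-ω j = trans (embed-⊛ (ω+1^ j) ωN) (cong embed (ω+1^-⊛-ω j))

  ω+1^-⊗-ω²+1 : ∀ n → embed (ω+1^ n) ⊗ ω²+1Ω Λ ≡ embed (B n)
  ω+1^-⊗-ω²+1 n = trans (embed-⊛ (ω+1^ n) ω²+1N) (cong embed (ω+1^-⊛-ω²+1 n))

  witnessed-∣ : ∀ {i j} z t → Valid Λ t → z ⊗ ω+1Ω Λ ⊗ ω+1Ω Λ ≡ embed (ω+1^ i) →
                t ⊗ (z ⊗ ω²+1Ω Λ) ≡ (z ⊗ ω²+1Ω Λ) ⊗ t → t ⊗ ωΩ Λ ≡ embed (ω+1^ j) ⊗ ωΩ Λ → i ∣ j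
  witnessed-∣ {i} {j} z t vt zx tB tω
    with n , refl , refl ← ⊗ω+1²≡power z i zx
    with s , refl ← ⊗ω≡fin⇒embed t j vt (trans tω (ω+1^-⊗-ω j)) =
    commutes-with-B⇒∣ n j s (embed-⊛-injective {s} {B n} {B n} {s} sB≡Bs)
      (embed-injective (trans (sym (embed-⊛ s ωN)) (trans tω (ω+1^-⊗-ω j))))
    where
    sB≡Bs : embed s ⊗ embed (B n) ≡ embed (B n) ⊗ embed s
    sB≡Bs = subst (λ w → embed s ⊗ w ≡ w ⊗ embed s) (ω+1^-⊗-ω²+1 n) tB

  pow-isPower : ∀ i → IsPowerOfω+1 (pow Λ (ω+1Ω Λ) i)
  pow-isPower i = subst IsPowerOfω+1 (sym (pow-ω+1 i)) (ω+1^-isPower i)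

  divFormula-sound : (x y : Ω Λ) → (∃[ z ] ∃[ t ] Sat Λ (env4 x y z t) divFormula) → Div Λ x y
  divFormula-sound (x , vx) (y , vy) (z , t , x-pow , y-pow , cases)
    with i , refl ← power-of-ω+1 x x-pow
    with j , refl ← power-of-ω+1 y y-pow =
    i , j , sym (pow-ω+1 i) , sym (pow-ω+1 j) , ∣-from cases
    where
    ∣-from : Sat Λ (env4 (embed (ω+1^ i) , vx) (embed (ω+1^ j) , vy) z t)
                   (bothOne ∨ᶠ (xIsω+1 ∨ᶠ witnessedDivision)) → i ∣ j
    ∣-from (inj₁ (x≡1 , y≡1))
      with refl ← ω+1^-injective {i} {0} (embed-injective x≡1)
      with refl ← ω+1^-injective {j} {0} (embed-injective y≡1) = 0 ∣0
    ∣-from (inj₂ (inj₁ x≡ω+1)) with refl ← ω+1^-injective {i} {1} (embed-injective x≡ω+1) = 1∣ j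
    ∣-from (inj₂ (inj₂ (zx , tB , tω))) = witnessed-∣ (proj₁ z) (proj₁ t) (proj₂ t) zx tB tω

  powers-satisfy-divFormula : ∀ i j (vx : Valid Λ (pow Λ (ω+1Ω Λ) i)) (vy : Valid Λ (pow Λ (ω+1Ω Λ) j)) → i ∣ j →
                              ∃[ z ] ∃[ t ] Sat Λ (env4 (_ , vx) (_ , vy) z t) divFormula
  powers-satisfy-divFormula zero j vx vy 0∣j with refl ← 0∣⇒≡0 0∣j =
    (_ , vx) , (_ , vx) , pow-isPower 0 , pow-isPower 0 , inj₁ (refl , refl)
  powers-satisfy-divFormula (suc zero) j vx vy _ =
    (_ , vx) , (_ , vx) , pow-isPower 1 , pow-isPower j , inj₂ (inj₁ refl)
  powers-satisfy-divFormula (suc (suc n)) _ vx vy (divides q refl) =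
    z , t , pow-isPower (suc (suc n)) , pow-isPower (q * suc (suc n)) , inj₂ (inj₂ (zx , tB , tω))
    where
    z t : Ω Λ
    z = embed (ω+1^ n) , embed-valid (ω+1^ n) (ω+1^-descending n)
    t = embed (powB n q) , embed-valid (powB n q) (powB-descending n q)
    zx : embed (ω+1^ n) ⊗ ω+1Ω Λ ⊗ ω+1Ω Λ ≡ pow Λ (ω+1Ω Λ) (suc (suc n))
    zx = cong (λ w → w ⊗ ω+1Ω Λ ⊗ ω+1Ω Λ) (sym (pow-ω+1 n))
    tB : embed (powB n q) ⊗ (embed (ω+1^ n) ⊗ ω²+1Ω Λ) ≡ (embed (ω+1^ n) ⊗ ω²+1Ω Λ) ⊗ embed (powB n q)
    tB = subst (λ w → embed (powB n q) ⊗ w ≡ w ⊗ embed (powB n q)) (sym (ω+1^-⊗-ω²+1 n))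
           (trans (embed-⊛ (powB n q) (B n))
                  (trans (cong embed (powB-⊛-B n q)) (sym (embed-⊛ (B n) (powB n q)))))
    tω : embed (powB n q) ⊗ ωΩ Λ ≡ pow Λ (ω+1Ω Λ) (q * suc (suc n)) ⊗ ωΩ Λ
    tω = trans (embed-⊛ (powB n q) ωN)
           (trans (cong embed (powB-⊛-ω n q))
                  (sym (trans (cong (_⊗ ωΩ Λ) (pow-ω+1 (q * suc (suc n)))) (ω+1^-⊗-ω (q * suc (suc n))))))

  divFormula-complete : (x y : Ω Λ) → Div Λ x y → ∃[ z ] ∃[ t ] Sat Λ (env4 x y z t) divFormula
  divFormula-complete (_ , vx) (_ , vy) (i , j , refl , refl , i∣j) = powers-satisfy-divFormula i j vx vy i∣j

mainTheorem5 : (Λ : OrdinalGt1) →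
    Σ (QF 4) (λ E → (x y : Ω Λ) →
      ((Div Λ x y → ∃[ z ] ∃[ t ] Sat Λ (env4 x y z t) E)
       × ((∃[ z ] ∃[ t ] Sat Λ (env4 x y z t) E) → Div Λ x y)))
mainTheorem5 Λ = divFormula , λ x y → divFormula-complete Λ x y , divFormula-sound Λ x y
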